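{- For every $n\geq1$, $$\sum_{e\in\mathbf{I}_n(021)}s^{\mathrm{dist}(e)}=\sum_{p\in SP_{n-1}}s^{\mathrm{asc}(p)}.$$
   Context: $\mathbf{I}_n$ is the set of integer sequences $e=(e_1,\dots,e_n)$ with $0\le e_i\le i-1$; $\mathbf{I}_n(021)$ is the subset avoiding the pattern $021$ (no $i<j<k$ with $e_i<e_k<e_j$). $\mathrm{dist}(e)$ is the number of distinct positive entries of $e$. A Schröder $m$-path is a lattice path from $(0,0)$ to $(2m,0)$ with steps $(1,1)$ (up), $(1,-1)$ (down), $(2,0)$ (flat) never going below the $x$-axis; $SP_m$ is the set of Schröder $m$-paths ($SP_0$ consists of the empty path). An ascent of a Schröder path is a maximal string of consecutive up steps, and $\mathrm{asc}(p)$ is the number of ascents of $p$. -}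

module Defs where

open import Level using (Level)
open import Data.Nat using (ℕ; zero; suc; _<ᵇ_; _+_)
open import Data.Nat.Properties using (_≟_)
open import Data.Bool using (Bool; true; false; _∧_; _∨_; not; if_then_else_)
open import Data.List using (List; []; _∷_; map; filterᵇ; concatMap; length; foldr; deduplicate; upTo; _++_)
open import Data.Bool.ListAction using (any)
open import Relation.Nullary.Decidable using (does)
open import Relation.Binary.PropositionalEquality using (_≡_)
open import Algebra.Bundles using (CommutativeSemiring)

allSeqs : ℕ → List (List ℕ)
allSeqs zero    = [] ∷ []
allSeqs (suc n) = concatMap (λ e → map (λ x → e ++ (x ∷ [])) (upTo (suc n))) (allSeqs n)

pairBad : ℕ → List ℕ → Bool
pairBad a []       = false
pairBad a (b ∷ rs) = any (λ c → (a <ᵇ c) ∧ (c <ᵇ b)) rs ∨ pairBad a rs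

-- e contains the pattern 021: ∃ i<j<k, e_i < e_k < e_j
contains021 : List ℕ → Bool
contains021 []       = false
contains021 (a ∷ rs) = pairBad a rs ∨ contains021 rs

I021 : ℕ → List (List ℕ)
I021 n = filterᵇ (λ e → not (contains021 e)) (allSeqs n)

dist : List ℕ → ℕ
dist e = length (deduplicate _≟_ (filterᵇ (λ x → 0 <ᵇ x) e))

-- Schröder paths, as words in the steps U = (1,1), D = (1,-1), F = (2,0).

data Step : Set where
  U D F : Step

words : ℕ → List (List Step)
words zero          = [] ∷ []
words (suc zero)    = map (U ∷_) (words zero) ++ map (D ∷_) (words zero)
words (suc (suc w)) = map (U ∷_) (words (suc w)) ++ map (D ∷_) (words (suc w))
                      ++ map (F ∷_) (words w)

validFrom : ℕ → List Step → Bool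
validFrom zero    []       = true
validFrom (suc h) []       = false
validFrom h       (U ∷ ps) = validFrom (suc h) ps
validFrom zero    (D ∷ ps) = false
validFrom (suc h) (D ∷ ps) = validFrom h ps
validFrom h       (F ∷ ps) = validFrom h ps

SP : ℕ → List (List Step)
SP m = filterᵇ (validFrom 0) (words (m + m))

isU : Step → Bool
isU U = true
isU _ = false

-- number of ascents (maximal runs of consecutive up steps);
-- the Bool records whether the previous step was an up step
ascFrom : Bool → List Step → ℕ
ascFrom prev []       = 0
ascFrom prev (U ∷ ps) = (if prev then 0 else 1) + ascFrom true ps
ascFrom prev (D ∷ ps) = ascFrom false ps
ascFrom prev (F ∷ ps) = ascFrom false ps

asc : List Step → ℕ
asc = ascFrom false

module _ {c ℓ : Level} (R : CommutativeSemiring c ℓ) where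
  open CommutativeSemiring R using (Carrier; 0#; 1#) renaming (_+_ to _⊕_; _*_ to _⊗_)

  pow : Carrier → ℕ → Carrier
  pow s zero    = 1#
  pow s (suc k) = s ⊗ pow s k

  genSum : {A : Set} → (A → ℕ) → Carrier → List A → Carrier
  genSum stat s xs = foldr (λ x acc → pow s (stat x) ⊕ acc) 0# xs

-- Grow a sequence of 𝐈ₙ(021) by appending entries.  Since e₁ = 0, a new entry x creates a
-- pattern 021 exactly when 0 < x < m for the current maximum m, and it adds a new distinct
-- positive value exactly when x > m.  So the generating function of the completions of a prefix
-- depends only on its length and maximum, in fact only on whether the maximum is 0 and on its
-- distance to the length, and it satisfies the recurrences W⁰, W⁺ below.
--
-- On the path side, let V j h be the generating function of the path suffixes that start at
-- height h and complete a Schröder j-path.  Splitting off the first step (D, F, or a whole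
-- ascent followed by D or F) gives V (j + 1) = step (V j).  The linear functionals
-- Ψ k f = Σᵢ C(k,i) sⁱ Σₕ (aboveⁱ f) h intertwine step with the recurrence of W⁺, whence
-- Ψ k (V j) = W⁺ k j and Ψ₀ k (V j) = W⁰ k j.  Both sides for 𝐈ₙ₊₁(021) and SPₙ thus equal
-- W⁰ 0 n = V n 0.

module Submission where

open import Level using (Level)
open import Data.Bool using (Bool; true; false; _∧_; _∨_; not; T; if_then_else_)
open import Data.Nat using (ℕ; zero; suc; _≤_; _<_; _⊔_; _<ᵇ_; z≤n; s≤s)
import Data.Nat as ℕ
import Data.Nat.Properties as ℕ
open import Data.Nat.Properties using (_<?_)
open import Data.List using (List; []; _∷_; _++_; _∷ʳ_; map; concatMap; filterᵇ; applyUpTo; upTo; foldr)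
open import Data.List.Relation.Unary.All using (All; []; _∷_; universal)
import Data.List.Relation.Unary.All as All
open import Data.List.Relation.Unary.All.Properties using (concat⁺; map⁺)
open import Data.Product using (∃-syntax; _,_)
open import Function using (_∘_)
open import Relation.Nullary using (yes; no)
open import Relation.Nullary.Decidable using (dec-true; dec-false)
open import Algebra.Bundles using (CommutativeSemiring)
open import Relation.Binary.PropositionalEquality using (_≡_; cong; cong₂; subst)
import Relation.Binary.PropositionalEquality as ≡
open import Defs

module AppendEntry where
  open import Data.Bool.ListAction using (any)
  open import Data.Bool.Solver using (module ∨-∧-Solver)
  open import Data.Bool.Properties using (∨-identityʳ; ∨-zeroʳ; ∧-zeroʳ; T-∨; T-∧)
  open import Data.Nat using (_+_; _≡ᵇ_)
  open import Data.Nat.Properties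
    using (_≟_; _≤?_; <ᵇ⇒<; <⇒<ᵇ; ≤-<-trans; m<n⇒m<o⊔n; m≤m⊔n; m≤n⊔m; <⇒≢; ≮⇒≥; ≰⇒≥; ≤-antisym;
           m≥n⇒m⊔n≡m; m≤n⇒m⊔n≡n; ⊔-identityʳ; ⊔-assoc; +-comm; +-identityʳ)
  open import Data.List using (filter; length; deduplicate)
  open import Data.List.Properties using (filter-++; filter-accept; length-++; ++-identityʳ)
  open import Data.Sum using (inj₁; inj₂)
  open import Data.Unit using (tt)
  open import Data.Empty using (⊥-elim)
  open import Function using (Equivalence)
  open import Relation.Nullary using (¬_; ¬?; T?)
  open ≡ using (refl; trans; sym; module ≡-Reasoning)

  open ∨-∧-Solver using (solve; _:=_; _:+_; _:*_)

  maxEntry : List ℕ → ℕ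
  maxEntry = foldr _⊔_ 0

  <ᵇ-⊔ : ∀ x a b → ((x <ᵇ a) ∨ (x <ᵇ b)) ≡ (x <ᵇ (a ⊔ b))
  <ᵇ-⊔ zero    zero    b       = refl
  <ᵇ-⊔ zero    (suc a) zero    = refl
  <ᵇ-⊔ zero    (suc a) (suc b) = refl
  <ᵇ-⊔ (suc x) zero    b       = refl
  <ᵇ-⊔ (suc x) (suc a) zero    = ∨-identityʳ _
  <ᵇ-⊔ (suc x) (suc a) (suc b) = <ᵇ-⊔ x a b

  any-<ᵇ : ∀ x t → any (x <ᵇ_) t ≡ (x <ᵇ maxEntry t)
  any-<ᵇ x []      = refl
  any-<ᵇ x (b ∷ t) = trans (cong ((x <ᵇ b) ∨_) (any-<ᵇ x t)) (<ᵇ-⊔ x b (maxEntry t))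

  any-∷ʳ : ∀ (p : ℕ → Bool) l x → any p (l ∷ʳ x) ≡ (any p l ∨ p x)
  any-∷ʳ p []      x = ∨-identityʳ (p x)
  any-∷ʳ p (a ∷ l) x = trans (cong (p a ∨_) (any-∷ʳ p l x))
    (solve 3 (λ a l x → a :+ (l :+ x) := (a :+ l) :+ x) refl (p a) (any p l) (p x))

  completes021 : List ℕ → ℕ → Bool
  completes021 []       x = false
  completes021 (a ∷ rs) x = ((a <ᵇ x) ∧ any (x <ᵇ_) rs) ∨ completes021 rs x

  pairBad-∷ʳ : ∀ a rs x → pairBad a (rs ∷ʳ x) ≡ (pairBad a rs ∨ ((a <ᵇ x) ∧ any (x <ᵇ_) rs))
  pairBad-∷ʳ a []       x = sym (∧-zeroʳ (a <ᵇ x))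
  pairBad-∷ʳ a (b ∷ rs) x = trans
    (cong₂ _∨_ (any-∷ʳ (λ c → (a <ᵇ c) ∧ (c <ᵇ b)) rs x) (pairBad-∷ʳ a rs x))
    (solve 5 (λ A B C P Q → (A :+ (B :* C)) :+ (P :+ (B :* Q)) := (A :+ P) :+ (B :* (C :+ Q))) refl
       (any (λ c → (a <ᵇ c) ∧ (c <ᵇ b)) rs) (a <ᵇ x) (x <ᵇ b) (pairBad a rs) (any (x <ᵇ_) rs))

  contains021-∷ʳ : ∀ l x → contains021 (l ∷ʳ x) ≡ (contains021 l ∨ completes021 l x)
  contains021-∷ʳ []       x = refl
  contains021-∷ʳ (a ∷ rs) x = trans
    (cong₂ _∨_ (pairBad-∷ʳ a rs x) (contains021-∷ʳ rs x))
    (solve 4 (λ p q r t → (p :+ q) :+ (r :+ t) := (p :+ r) :+ (q :+ t)) refl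
       (pairBad a rs) ((a <ᵇ x) ∧ any (x <ᵇ_) rs) (contains021 rs) (completes021 rs x))

  inGap : ℕ → ℕ → Bool
  inGap m x = (0 <ᵇ x) ∧ (x <ᵇ m)

  completes021⇒inGap : ∀ t x → T (completes021 t x) → T (inGap (maxEntry t) x)
  completes021⇒inGap (a ∷ rs) x p with Equivalence.to T-∨ p
  ... | inj₁ q with Equivalence.to T-∧ q
  ...   | a<x , x<rs = Equivalence.from T-∧
    ( <⇒<ᵇ (≤-<-trans z≤n (<ᵇ⇒< a x a<x))
    , <⇒<ᵇ (m<n⇒m<o⊔n a (<ᵇ⇒< x _ (subst T (any-<ᵇ x rs) x<rs))) )
  completes021⇒inGap (a ∷ rs) x p | inj₂ q with Equivalence.to T-∧ (completes021⇒inGap rs x q)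
  ... | 0<x , x<rs = Equivalence.from T-∧ (0<x , <⇒<ᵇ (m<n⇒m<o⊔n a (<ᵇ⇒< x _ x<rs)))

  ∨-absorbs-implied : ∀ b c → (T c → T b) → (b ∨ c) ≡ b
  ∨-absorbs-implied true  c     _ = refl
  ∨-absorbs-implied false true  f = ⊥-elim (f tt)
  ∨-absorbs-implied false false _ = refl

  contains021-0∷-∷ʳ : ∀ t x → contains021 ((0 ∷ t) ∷ʳ x) ≡ (contains021 (0 ∷ t) ∨ inGap (maxEntry t) x)
  contains021-0∷-∷ʳ t x = trans (contains021-∷ʳ (0 ∷ t) x) (cong (contains021 (0 ∷ t) ∨_) completes)
    where
    completes : completes021 (0 ∷ t) x ≡ inGap (maxEntry t) x
    completes = trans (cong (λ b → ((0 <ᵇ x) ∧ b) ∨ completes021 t x) (any-<ᵇ x t))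
                      (∨-absorbs-implied _ _ (completes021⇒inGap t x))

  maxEntry-∷ʳ : ∀ l x → maxEntry (l ∷ʳ x) ≡ maxEntry l ⊔ x
  maxEntry-∷ʳ []      x = ⊔-identityʳ x
  maxEntry-∷ʳ (a ∷ l) x = trans (cong (a ⊔_) (maxEntry-∷ʳ l x)) (sym (⊔-assoc a (maxEntry l) x))

  _∈ᵇ_ : ℕ → List ℕ → Bool
  x ∈ᵇ l = any (_≡ᵇ x) l

  deduplicate-∷ʳ : ∀ l x → deduplicate _≟_ (l ∷ʳ x) ≡ deduplicate _≟_ l ++ (if x ∈ᵇ l then [] else x ∷ [])
  deduplicate-∷ʳ []      x = refl
  deduplicate-∷ʳ (a ∷ l) x = cong (a ∷_) (begin
    filter (¬? ∘ (a ≟_)) (deduplicate _≟_ (l ∷ʳ x))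
      ≡⟨ cong (filter (¬? ∘ (a ≟_))) (deduplicate-∷ʳ l x) ⟩
    filter (¬? ∘ (a ≟_)) (deduplicate _≟_ l ++ (if x ∈ᵇ l then [] else x ∷ []))
      ≡⟨ filter-++ (¬? ∘ (a ≟_)) (deduplicate _≟_ l) _ ⟩
    filter (¬? ∘ (a ≟_)) (deduplicate _≟_ l) ++ filter (¬? ∘ (a ≟_)) (if x ∈ᵇ l then [] else x ∷ [])
      ≡⟨ cong (filter (¬? ∘ (a ≟_)) (deduplicate _≟_ l) ++_) (last (x ∈ᵇ l)) ⟩
    filter (¬? ∘ (a ≟_)) (deduplicate _≟_ l) ++ (if (a ≡ᵇ x) ∨ (x ∈ᵇ l) then [] else x ∷ []) ∎)
    where
    open ≡-Reasoning
    last : ∀ b → filter (¬? ∘ (a ≟_)) (if b then [] else x ∷ []) ≡ (if (a ≡ᵇ x) ∨ b then [] else x ∷ [])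
    last true  = cong (λ b → if b then [] else x ∷ []) (sym (∨-zeroʳ (a ≡ᵇ x)))
    last false with a ≡ᵇ x
    ... | true  = refl
    ... | false = refl

  positives : List ℕ → List ℕ
  positives = filterᵇ (0 <ᵇ_)

  ∈ᵇ-positives->max : ∀ l x → maxEntry l < x → (x ∈ᵇ positives l) ≡ false
  ∈ᵇ-positives->max []      x _ = refl
  ∈ᵇ-positives->max (a ∷ l) x l<x with 0 <ᵇ a
  ... | true  = cong₂ _∨_ (dec-false (a ≟ x) (<⇒≢ (≤-<-trans (m≤m⊔n a (maxEntry l)) l<x)))
                      (∈ᵇ-positives->max l x (≤-<-trans (m≤n⊔m a (maxEntry l)) l<x))
  ... | false = ∈ᵇ-positives->max l x (≤-<-trans (m≤n⊔m a (maxEntry l)) l<x)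

  ∈ᵇ-positives-max : ∀ l x → maxEntry l ≡ x → 0 < x → (x ∈ᵇ positives l) ≡ true
  ∈ᵇ-positives-max []      x refl ()
  ∈ᵇ-positives-max (a ∷ l) x a⊔l≡x 0<x with a ≤? maxEntry l
  ... | yes a≤l = with-head (∈ᵇ-positives-max l x (trans (sym (m≤n⇒m⊔n≡n a≤l)) a⊔l≡x) 0<x)
    where
    with-head : (x ∈ᵇ positives l) ≡ true → (x ∈ᵇ positives (a ∷ l)) ≡ true
    with-head x∈l with 0 <ᵇ a
    ... | true  = trans (cong ((a ≡ᵇ x) ∨_) x∈l) (∨-zeroʳ _)
    ... | false = x∈l
  ... | no a≰l with refl ← trans (sym (m≥n⇒m⊔n≡m (≰⇒≥ a≰l))) a⊔l≡x rewrite dec-true (0 <? a) 0<x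
    = cong (_∨ (a ∈ᵇ positives l)) (dec-true (a ≟ a) refl)

  dist-∷ʳ-positive : ∀ e x → 0 < x → dist (e ∷ʳ x) ≡ dist e + (if x ∈ᵇ positives e then 0 else 1)
  dist-∷ʳ-positive e x 0<x = begin
    length (deduplicate _≟_ (positives (e ∷ʳ x)))
      ≡⟨ cong (length ∘ deduplicate _≟_) (filter-++ (T? ∘ (0 <ᵇ_)) e (x ∷ [])) ⟩
    length (deduplicate _≟_ (positives e ++ positives (x ∷ [])))
      ≡⟨ cong (λ l → length (deduplicate _≟_ (positives e ++ l))) (filter-accept (T? ∘ (0 <ᵇ_)) {xs = []} (<⇒<ᵇ 0<x)) ⟩
    length (deduplicate _≟_ (positives e ∷ʳ x))
      ≡⟨ cong length (deduplicate-∷ʳ (positives e) x) ⟩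
    length (deduplicate _≟_ (positives e) ++ (if x ∈ᵇ positives e then [] else x ∷ []))
      ≡⟨ length-++ (deduplicate _≟_ (positives e)) ⟩
    dist e + length (if x ∈ᵇ positives e then [] else x ∷ [])
      ≡⟨ cong (dist e +_) (length-if (x ∈ᵇ positives e)) ⟩
    dist e + (if x ∈ᵇ positives e then 0 else 1) ∎
    where
    open ≡-Reasoning
    length-if : ∀ b → length (if b then [] else x ∷ []) ≡ (if b then 0 else 1)
    length-if true  = refl
    length-if false = refl

  outsideGap-≥⇒≡ : ∀ m x → ¬ T (inGap m (suc x)) → ¬ m < suc x → m ≡ suc x
  outsideGap-≥⇒≡ m x notInGap m≮x =
    ≤-antisym (≮⇒≥ (notInGap ∘ λ x<m → Equivalence.from T-∧ (tt , <⇒<ᵇ x<m))) (≮⇒≥ m≮x)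

  dist-∷ʳ : ∀ e x → ¬ T (inGap (maxEntry e) x) →
            dist (e ∷ʳ x) ≡ (if maxEntry e <ᵇ x then suc (dist e) else dist e)
  dist-∷ʳ e zero    _ =
    cong (length ∘ deduplicate _≟_) (trans (filter-++ (T? ∘ (0 <ᵇ_)) e (0 ∷ [])) (++-identityʳ (positives e)))
  dist-∷ʳ e (suc x) notInGap with maxEntry e <? suc x
  ... | yes max<x rewrite dec-true (maxEntry e <? suc x) max<x
                        | dist-∷ʳ-positive e (suc x) (s≤s z≤n)
                        | ∈ᵇ-positives->max e (suc x) max<x
    = +-comm (dist e) 1
  ... | no  max≮x rewrite dec-false (maxEntry e <? suc x) max≮x
                        | dist-∷ʳ-positive e (suc x) (s≤s z≤n)
                        | ∈ᵇ-positives-max e (suc x) (outsideGap-≥⇒≡ (maxEntry e) x notInGap max≮x) (s≤s z≤n)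
    = +-identityʳ (dist e)

open AppendEntry

module FiniteSums {c ℓ : Level} (R : CommutativeSemiring c ℓ) where
  open CommutativeSemiring R hiding (zero)
  open import Relation.Binary.Reasoning.Setoid setoid
  open import Algebra.Properties.CommutativeSemigroup +-commutativeSemigroup using (interchange)

  ∑ : ℕ → (ℕ → Carrier) → Carrier
  ∑ zero    f = 0#
  ∑ (suc n) f = f 0 + ∑ n (f ∘ suc)

  syntax ∑ n (λ i → e) = ∑[ i < n ] e

  ∑-cong< : ∀ n {f g : ℕ → Carrier} → (∀ i → i < n → f i ≈ g i) → ∑ n f ≈ ∑ n g
  ∑-cong< zero    _  = refl
  ∑-cong< (suc n) eq = +-cong (eq 0 (s≤s z≤n)) (∑-cong< n (λ i i<n → eq (suc i) (s≤s i<n)))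

  ∑-cong : ∀ n {f g : ℕ → Carrier} → (∀ i → f i ≈ g i) → ∑ n f ≈ ∑ n g
  ∑-cong n eq = ∑-cong< n (λ i _ → eq i)

  ∑-zero : ∀ n {f : ℕ → Carrier} → (∀ i → i < n → f i ≈ 0#) → ∑ n f ≈ 0#
  ∑-zero zero    _  = refl
  ∑-zero (suc n) eq = trans (+-cong (eq 0 (s≤s z≤n)) (∑-zero n (λ i i<n → eq (suc i) (s≤s i<n)))) (+-identityˡ 0#)

  ∑-+ : ∀ n (f g : ℕ → Carrier) → ∑[ i < n ] (f i + g i) ≈ ∑ n f + ∑ n g
  ∑-+ zero    f g = sym (+-identityˡ 0#)
  ∑-+ (suc n) f g = trans (+-congˡ (∑-+ n (f ∘ suc) (g ∘ suc))) (interchange (f 0) (g 0) _ _)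

  ∑-*ˡ : ∀ n a (f : ℕ → Carrier) → ∑[ i < n ] (a * f i) ≈ a * ∑ n f
  ∑-*ˡ zero    a f = sym (zeroʳ a)
  ∑-*ˡ (suc n) a f = trans (+-congˡ (∑-*ˡ n a (f ∘ suc))) (sym (distribˡ a _ _))

  ∑-last : ∀ n (f : ℕ → Carrier) → ∑ (suc n) f ≈ ∑ n f + f n
  ∑-last zero    f = +-comm (f 0) 0#
  ∑-last (suc n) f = trans (+-congˡ (∑-last n (f ∘ suc))) (sym (+-assoc _ _ _))

  ∑-split : ∀ a b (f : ℕ → Carrier) → ∑ (a ℕ.+ b) f ≈ ∑ a f + ∑[ i < b ] f (a ℕ.+ i)
  ∑-split zero    b f = sym (+-identityˡ _)
  ∑-split (suc a) b f = trans (+-congˡ (∑-split a b (f ∘ suc))) (sym (+-assoc _ _ _))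

  ∑-reverse : ∀ n (f : ℕ → Carrier) → ∑[ i < suc n ] f (n ℕ.∸ i) ≈ ∑ (suc n) f
  ∑-reverse zero    f = refl
  ∑-reverse (suc n) f = trans (+-congˡ (∑-reverse n f)) (trans (+-comm _ _) (sym (∑-last (suc n) f)))

  listSum : {A : Set} → (A → Carrier) → List A → Carrier
  listSum g = foldr (λ x acc → g x + acc) 0#

  listSum-++ : {A : Set} (g : A → Carrier) (xs ys : List A) → listSum g (xs ++ ys) ≈ listSum g xs + listSum g ys
  listSum-++ g []       ys = sym (+-identityˡ _)
  listSum-++ g (x ∷ xs) ys = trans (+-congˡ (listSum-++ g xs ys)) (sym (+-assoc _ _ _))

  listSum-concatMap : {A B : Set} (g : B → Carrier) (f : A → List B) (xs : List A) →
                      listSum g (concatMap f xs) ≈ listSum (listSum g ∘ f) xs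
  listSum-concatMap g f []       = refl
  listSum-concatMap g f (x ∷ xs) = trans (listSum-++ g (f x) (concatMap f xs)) (+-congˡ (listSum-concatMap g f xs))

  listSum-map : {A B : Set} (g : B → Carrier) (f : A → B) (xs : List A) → listSum g (map f xs) ≡ listSum (g ∘ f) xs
  listSum-map g f []       = ≡.refl
  listSum-map g f (x ∷ xs) = cong (g (f x) +_) (listSum-map g f xs)

  listSum-applyUpTo : (g : ℕ → Carrier) (f : ℕ → ℕ) (n : ℕ) → listSum g (applyUpTo f n) ≡ ∑[ i < n ] g (f i)
  listSum-applyUpTo g f zero    = ≡.refl
  listSum-applyUpTo g f (suc n) = cong (g (f 0) +_) (listSum-applyUpTo g (f ∘ suc) n)

  listSum-cong : {A : Set} {g h : A → Carrier} → (∀ x → g x ≈ h x) → ∀ xs → listSum g xs ≈ listSum h xs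
  listSum-cong eq []       = refl
  listSum-cong eq (x ∷ xs) = +-cong (eq x) (listSum-cong eq xs)

  listSum-zero : {A : Set} {g : A → Carrier} → (∀ x → g x ≈ 0#) → ∀ xs → listSum g xs ≈ 0#
  listSum-zero eq []       = refl
  listSum-zero eq (x ∷ xs) = trans (+-cong (eq x) (listSum-zero eq xs)) (+-identityˡ 0#)

  listSum-cong-All : {A : Set} {P : A → Set} {g h : A → Carrier} → (∀ {x} → P x → g x ≈ h x) →
                   ∀ {xs} → All P xs → listSum g xs ≈ listSum h xs
  listSum-cong-All eq []         = refl
  listSum-cong-All eq (px ∷ pxs) = +-cong (eq px) (listSum-cong-All eq pxs)

  listSum-*ˡ : {A : Set} (a : Carrier) (g : A → Carrier) (xs : List A) → listSum (λ x → a * g x) xs ≈ a * listSum g xs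
  listSum-*ˡ a g []       = sym (zeroʳ a)
  listSum-*ˡ a g (x ∷ xs) = trans (+-congˡ (listSum-*ˡ a g xs)) (sym (distribˡ a _ _))

  listSum-filterᵇ : {A : Set} (g : A → Carrier) (p : A → Bool) (xs : List A) →
                    listSum g (filterᵇ p xs) ≈ listSum (λ x → if p x then g x else 0#) xs
  listSum-filterᵇ g p []       = refl
  listSum-filterᵇ g p (x ∷ xs) with p x
  ... | true  = +-congˡ (listSum-filterᵇ g p xs)
  ... | false = trans (listSum-filterᵇ g p xs) (sym (+-identityˡ _))

module Recurrences {c ℓ : Level} (R : CommutativeSemiring c ℓ) (s : CommutativeSemiring.Carrier R) where
  open CommutativeSemiring R hiding (zero)
  open FiniteSums R

  -- W⁺ d j counts the completions by j entries of a prefix whose positive maximum lies d + 1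
  -- below its length, W⁰ k j those of the all-zero prefix of length k + 1.
  W⁺ : ℕ → ℕ → Carrier
  W⁺ d zero    = 1#
  W⁺ d (suc j) = (W⁺ (suc d) j + W⁺ (suc d) j) + s * ∑[ i < suc d ] W⁺ i j

  W⁰ : ℕ → ℕ → Carrier
  W⁰ k zero    = 1#
  W⁰ k (suc j) = W⁰ (suc k) j + s * ∑[ i < suc k ] W⁺ i j

module InversionSequences {c ℓ : Level} (R : CommutativeSemiring c ℓ) (s : CommutativeSemiring.Carrier R) where
  open CommutativeSemiring R hiding (zero)
  open FiniteSums R
  open Recurrences R s
  open import Relation.Binary.Reasoning.Setoid setoid

  weight : List ℕ → Carrier
  weight e = if not (contains021 e) then pow R s (dist e) else 0#

  entryFactor : ℕ → ℕ → Carrier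
  entryFactor m x = if inGap m x then 0# else (if m <ᵇ x then s else 1#)

  entryFactor-gap : ∀ {m x} → 0 < x → x < m → entryFactor m x ≡ 0#
  entryFactor-gap {m} {x} 0<x x<m rewrite dec-true (0 <? x) 0<x | dec-true (x <? m) x<m = ≡.refl

  entryFactor-top : ∀ m → entryFactor (suc m) (suc m) ≡ 1#
  entryFactor-top m rewrite dec-false (m <? m) (ℕ.n≮n m) = ≡.refl

  entryFactor-above : ∀ {m x} → m < x → entryFactor m x ≡ s
  entryFactor-above {m} {suc x} m<x rewrite dec-false (suc x <? m) (ℕ.<⇒≯ m<x) | dec-true (m <? suc x) m<x = ≡.refl

  weight-∷ʳ : ∀ t x → weight ((0 ∷ t) ∷ʳ x) ≈ weight (0 ∷ t) * entryFactor (maxEntry t) x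
  weight-∷ʳ t x rewrite contains021-0∷-∷ʳ t x with contains021 (0 ∷ t) | inGap (maxEntry t) x in gap
  ... | true  | _     = sym (zeroˡ _)
  ... | false | true  = sym (zeroʳ _)
  ... | false | false rewrite dist-∷ʳ (0 ∷ t) x (subst T gap) with maxEntry t <ᵇ x
  ...   | true  = *-comm s _
  ...   | false = sym (*-identityʳ _)

  -- k is the length of the prefix and m its maximum, so the next entry ranges over 0 … k.
  completionGF : ℕ → ℕ → ℕ → Carrier
  completionGF k m zero    = 1#
  completionGF k m (suc j) = ∑[ x < suc k ] (entryFactor m x * completionGF (suc k) (m ⊔ x) j)

  completionGF-positive : ∀ j m d → completionGF (suc (suc m ℕ.+ d)) (suc m) j ≈ W⁺ d j
  completionGF-positive zero    m d = refl
  completionGF-positive (suc j) m d = begin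
    f 0 + ∑ K (f ∘ suc)
      ≡⟨ cong (λ n → f 0 + ∑ n (f ∘ suc)) K≡ ⟩
    f 0 + ∑ (suc m ℕ.+ suc d) (f ∘ suc)
      ≈⟨ +-congˡ (trans (∑-split (suc m) (suc d) (f ∘ suc)) (+-congʳ (∑-last m (f ∘ suc)))) ⟩
    f 0 + ((∑ m (f ∘ suc) + f (suc m)) + ∑[ i < suc d ] f (suc (suc m ℕ.+ i)))
      ≈⟨ +-cong ground (+-cong (+-cong gap top) above) ⟩
    W + ((0# + W) + s * ∑[ i < suc d ] W⁺ i j)
      ≈⟨ +-congˡ (+-congʳ (+-identityˡ W)) ⟩
    W + (W + s * ∑[ i < suc d ] W⁺ i j)
      ≈⟨ +-assoc W W _ ⟨
    (W + W) + s * ∑[ i < suc d ] W⁺ i j ∎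
    where
    K = suc (suc m ℕ.+ d)
    K≡ : K ≡ suc m ℕ.+ suc d
    K≡ = ≡.sym (ℕ.+-suc (suc m) d)
    f : ℕ → Carrier
    f x = entryFactor (suc m) x * completionGF (suc K) (suc m ⊔ x) j
    W = W⁺ (suc d) j
    stay : completionGF (suc K) (suc m) j ≈ W
    stay = trans (reflexive (cong (λ k → completionGF (suc k) (suc m) j) K≡)) (completionGF-positive j m (suc d))
    ground : f 0 ≈ W
    ground = trans (*-identityˡ _) stay
    gap : ∑ m (f ∘ suc) ≈ 0#
    gap = ∑-zero m (λ i i<m → trans (*-congʳ (reflexive (entryFactor-gap (s≤s z≤n) (s≤s i<m)))) (zeroˡ _))
    top : f (suc m) ≈ W
    top = trans (*-cong (reflexive (entryFactor-top m)) (reflexive (cong (λ n → completionGF (suc K) n j) (ℕ.⊔-idem (suc m)))))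
                (trans (*-identityˡ _) stay)
    m<newMax : ∀ i → suc m < suc (suc m ℕ.+ i)
    m<newMax i = s≤s (s≤s (ℕ.m≤m+n m i))
    newMax : ∀ i → i < suc d → completionGF (suc K) (suc m ⊔ suc (suc m ℕ.+ i)) j ≈ W⁺ (d ℕ.∸ i) j
    newMax i (s≤s i≤d) =
      trans (reflexive (cong₂ (λ k n → completionGF k n j) K+1≡ (ℕ.m≤n⇒m⊔n≡n (ℕ.<⇒≤ (m<newMax i)))))
            (completionGF-positive j (suc m ℕ.+ i) (d ℕ.∸ i))
      where
      K+1≡ : suc K ≡ suc (suc (suc m ℕ.+ i) ℕ.+ (d ℕ.∸ i))
      K+1≡ = cong (suc ∘ suc) (≡.sym (≡.trans (ℕ.+-assoc (suc m) i (d ℕ.∸ i))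
                                              (cong (suc m ℕ.+_) (ℕ.m+[n∸m]≡n i≤d))))
    above : ∑[ i < suc d ] f (suc (suc m ℕ.+ i)) ≈ s * ∑[ i < suc d ] W⁺ i j
    above = begin
      ∑[ i < suc d ] f (suc (suc m ℕ.+ i))
        ≈⟨ ∑-cong< (suc d) (λ i i<d+1 → *-cong (reflexive (entryFactor-above (m<newMax i))) (newMax i i<d+1)) ⟩
      ∑[ i < suc d ] (s * W⁺ (d ℕ.∸ i) j) ≈⟨ ∑-*ˡ (suc d) s (λ i → W⁺ (d ℕ.∸ i) j) ⟩
      s * ∑[ i < suc d ] W⁺ (d ℕ.∸ i) j  ≈⟨ *-congˡ (∑-reverse d (λ i → W⁺ i j)) ⟩
      s * ∑[ i < suc d ] W⁺ i j          ∎

  completionGF-zero : ∀ j k → completionGF (suc k) 0 j ≈ W⁰ k j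
  completionGF-zero zero    k = refl
  completionGF-zero (suc j) k = +-cong (trans (*-identityˡ _) (completionGF-zero j (suc k))) (begin
    ∑[ x < suc k ] (s * completionGF (suc (suc k)) (suc x) j)
      ≈⟨ ∑-cong< (suc k) (λ x x≤k → *-congˡ {s} (firstMax x x≤k)) ⟩
    ∑[ x < suc k ] (s * W⁺ (k ℕ.∸ x) j) ≈⟨ ∑-*ˡ (suc k) s (λ x → W⁺ (k ℕ.∸ x) j) ⟩
    s * ∑[ x < suc k ] W⁺ (k ℕ.∸ x) j  ≈⟨ *-congˡ (∑-reverse k (λ i → W⁺ i j)) ⟩
    s * ∑[ i < suc k ] W⁺ i j          ∎)
    where
    firstMax : ∀ x → x < suc k → completionGF (suc (suc k)) (suc x) j ≈ W⁺ (k ℕ.∸ x) j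
    firstMax x (s≤s x≤k) = trans (reflexive (cong (λ n → completionGF (suc (suc n)) (suc x) j) (≡.sym (ℕ.m+[n∸m]≡n x≤k))))
                                 (completionGF-positive j x (k ℕ.∸ x))

  completionsGF : ℕ → ℕ → List (List ℕ) → Carrier
  completionsGF k j = listSum (λ e → weight e * completionGF k (maxEntry e) j)

  StartsWithZero : List ℕ → Set
  StartsWithZero e = ∃[ t ] e ≡ 0 ∷ t

  extend : ℕ → List (List ℕ) → List (List ℕ)
  extend k = concatMap (λ e → map (e ∷ʳ_) (upTo (suc k)))

  completionsGF-extend : ∀ k j {P} → All StartsWithZero P →
                         completionsGF (suc k) j (extend k P) ≈ completionsGF k (suc j) P
  completionsGF-extend k j {P} P₀ = begin
    completionsGF (suc k) j (extend k P)                ≈⟨ listSum-concatMap _ _ P ⟩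
    listSum (completionsGF (suc k) j ∘ extensions) P    ≈⟨ listSum-cong-All extensions-GF P₀ ⟩
    completionsGF k (suc j) P                           ∎
    where
    extensions : List ℕ → List (List ℕ)
    extensions e = map (e ∷ʳ_) (upTo (suc k))
    extensions-GF : ∀ {e} → StartsWithZero e →
                    completionsGF (suc k) j (extensions e) ≈ weight e * completionGF k (maxEntry e) (suc j)
    extensions-GF {e} (t , ≡.refl) = begin
      completionsGF (suc k) j (extensions e)
        ≡⟨ ≡.trans (listSum-map _ _ (upTo (suc k))) (listSum-applyUpTo _ (λ x → x) (suc k)) ⟩
      ∑[ x < suc k ] (weight (e ∷ʳ x) * completionGF (suc k) (maxEntry (t ∷ʳ x)) j)
        ≈⟨ ∑-cong (suc k) (λ x → *-cong (weight-∷ʳ t x)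
                                        (reflexive (cong (λ m → completionGF (suc k) m j) (maxEntry-∷ʳ t x)))) ⟩
      ∑[ x < suc k ] ((weight e * entryFactor (maxEntry t) x) * completionGF (suc k) (maxEntry t ⊔ x) j)
        ≈⟨ ∑-cong (suc k) (λ x → *-assoc (weight e) (entryFactor (maxEntry t) x) (completionGF (suc k) (maxEntry t ⊔ x) j)) ⟩
      ∑[ x < suc k ] (weight e * (entryFactor (maxEntry t) x * completionGF (suc k) (maxEntry t ⊔ x) j))
        ≈⟨ ∑-*ˡ (suc k) (weight e) (λ x → entryFactor (maxEntry t) x * completionGF (suc k) (maxEntry t ⊔ x) j) ⟩
      weight e * completionGF k (maxEntry e) (suc j) ∎

  allSeqs-StartWithZero : ∀ k → All StartsWithZero (allSeqs (suc k))
  allSeqs-StartWithZero zero    = ([] , ≡.refl) ∷ []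
  allSeqs-StartWithZero (suc k) = concat⁺ (map⁺ (All.map extensions-StartWithZero (allSeqs-StartWithZero k)))
    where
    extensions-StartWithZero : ∀ {e} → StartsWithZero e → All StartsWithZero (map (e ∷ʳ_) (upTo (suc (suc k))))
    extensions-StartWithZero (t , ≡.refl) = map⁺ (universal (λ x → t ∷ʳ x , ≡.refl) _)

  completionsGF-allSeqs : ∀ i j → completionsGF (suc i) j (allSeqs (suc i)) ≈ completionGF 1 0 (i ℕ.+ j)
  completionsGF-allSeqs zero    j = trans (+-identityʳ _) (*-identityˡ _)
  completionsGF-allSeqs (suc i) j = begin
    completionsGF (suc (suc i)) j (allSeqs (suc (suc i))) ≈⟨ completionsGF-extend (suc i) j (allSeqs-StartWithZero i) ⟩
    completionsGF (suc i) (suc j) (allSeqs (suc i))       ≈⟨ completionsGF-allSeqs i (suc j) ⟩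
    completionGF 1 0 (i ℕ.+ suc j)                         ≡⟨ cong (completionGF 1 0) (ℕ.+-suc i j) ⟩
    completionGF 1 0 (suc i ℕ.+ j)                         ∎

  I021-GF : ∀ n → genSum R dist s (I021 (suc n)) ≈ W⁰ 0 n
  I021-GF n = begin
    genSum R dist s (I021 (suc n))                       ≈⟨ listSum-filterᵇ _ _ (allSeqs (suc n)) ⟩
    listSum weight (allSeqs (suc n))                     ≈⟨ listSum-cong (λ e → sym (*-identityʳ (weight e))) (allSeqs (suc n)) ⟩
    completionsGF (suc n) 0 (allSeqs (suc n))            ≈⟨ completionsGF-allSeqs n 0 ⟩
    completionGF 1 0 (n ℕ.+ 0)                           ≡⟨ cong (completionGF 1 0) (ℕ.+-identityʳ n) ⟩
    completionGF 1 0 n                                   ≈⟨ completionGF-zero n 0 ⟩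
    W⁰ 0 n                                               ∎

module Profiles {c ℓ : Level} (R : CommutativeSemiring c ℓ) (s : CommutativeSemiring.Carrier R) where
  open CommutativeSemiring R hiding (zero)
  open FiniteSums R
  open import Algebra.Solver.Ring.NaturalCoefficients.Default R
  open import Relation.Binary.Reasoning.Setoid setoid

  Profile : Set c
  Profile = ℕ → Carrier

  shiftUp : Profile → Profile
  shiftUp f zero    = 0#
  shiftUp f (suc h) = f h

  shiftDown : Profile → Profile
  shiftDown f h = f (suc h)

  δ : Profile
  δ zero    = 1#
  δ (suc _) = 0#

  -- Profiles vanishing from height B on, for which tailSum f h sums f over all heights ≥ h.
  module Truncated (B : ℕ) where

    Bounded : Profile → Set ℓ
    Bounded f = ∀ h → B ≤ h → f h ≈ 0#

    tailSum : Profile → ℕ → Carrier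
    tailSum f h = ∑[ i < suc B ] f (h ℕ.+ i)

    total : Profile → Carrier
    total f = tailSum f 0

    above : Profile → Profile
    above f h = tailSum f (suc h)

    -- A suffix from height h starts with D, with F, or with an ascent (weight s) followed by D or F.
    step : Profile → Profile
    step f h = shiftUp f h + f h + s * (f h + above f h) + s * above f h

    tailSum-∷ : ∀ (f : Profile) h → f (suc h ℕ.+ B) ≈ 0# → tailSum f h ≈ f h + tailSum f (suc h)
    tailSum-∷ f h last≈0 = +-cong (reflexive (≡.cong f (ℕ.+-identityʳ h))) (sym (begin
      ∑[ i < suc B ] f (suc h ℕ.+ i)        ≈⟨ ∑-last B (λ i → f (suc h ℕ.+ i)) ⟩
      ∑[ i < B ] f (suc h ℕ.+ i) + f (suc h ℕ.+ B) ≈⟨ trans (+-congˡ last≈0) (+-identityʳ _) ⟩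
      ∑[ i < B ] f (suc h ℕ.+ i)            ≈⟨ ∑-cong B (λ i → reflexive (≡.cong f (≡.sym (ℕ.+-suc h i)))) ⟩
      ∑[ i < B ] f (h ℕ.+ suc i)            ∎))

    tailSum-∷-bounded : ∀ {f} → Bounded f → ∀ h → tailSum f h ≈ f h + tailSum f (suc h)
    tailSum-∷-bounded {f} bounded h = tailSum-∷ f h (bounded _ (ℕ.m≤n+m B (suc h)))

    tailSum-cong : ∀ {f g : Profile} → (∀ h → f h ≈ g h) → ∀ h → tailSum f h ≈ tailSum g h
    tailSum-cong eq h = ∑-cong (suc B) (λ i → eq (h ℕ.+ i))

    tailSum-+ : ∀ (f g : Profile) h → tailSum (λ i → f i + g i) h ≈ tailSum f h + tailSum g h
    tailSum-+ f g h = ∑-+ (suc B) (λ i → f (h ℕ.+ i)) (λ i → g (h ℕ.+ i))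

    tailSum-* : ∀ a (f : Profile) h → tailSum (λ i → a * f i) h ≈ a * tailSum f h
    tailSum-* a f h = ∑-*ˡ (suc B) a (λ i → f (h ℕ.+ i))

    tailSum-bounded : ∀ {f} → Bounded f → ∀ h → B ≤ h → tailSum f h ≈ 0#
    tailSum-bounded bounded h B≤h = ∑-zero (suc B) (λ i _ → bounded (h ℕ.+ i) (ℕ.≤-trans B≤h (ℕ.m≤m+n h i)))

    above-bounded : ∀ {f} → Bounded f → Bounded (above f)
    above-bounded bounded h B≤h = tailSum-bounded bounded (suc h) (ℕ.m≤n⇒m≤1+n B≤h)

    shiftDown-bounded : ∀ {f} → Bounded f → Bounded (shiftDown f)
    shiftDown-bounded bounded h B≤h = bounded (suc h) (ℕ.m≤n⇒m≤1+n B≤h)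

    module Linear (φ : Profile → Carrier)
             (φ-+ : ∀ f g → φ (λ h → f h + g h) ≈ φ f + φ g)
             (φ-* : ∀ a f → φ (λ h → a * f h) ≈ a * φ f) where

      φ-step : ∀ f → φ (step f) ≈ φ (shiftUp f) + φ f + s * (φ f + φ (above f)) + s * φ (above f)
      φ-step f = trans (φ-+ _ _) (+-cong (trans (φ-+ _ _) (+-cong (φ-+ _ _) (trans (φ-* s _) (*-congˡ (φ-+ _ _)))))
                                         (φ-* s _))

    above-cong : ∀ {f g : Profile} → (∀ h → f h ≈ g h) → ∀ h → above f h ≈ above g h
    above-cong eq h = tailSum-cong eq (suc h)

    Ψ : ℕ → Profile → Carrier
    Ψ zero    f = total f
    Ψ (suc k) f = Ψ k f + s * Ψ k (above f)

    Ψ-cong : ∀ k {f g : Profile} → (∀ h → f h ≈ g h) → Ψ k f ≈ Ψ k g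
    Ψ-cong zero    eq = tailSum-cong eq 0
    Ψ-cong (suc k) eq = +-cong (Ψ-cong k eq) (*-congˡ (Ψ-cong k (above-cong eq)))

    Ψ-+ : ∀ k (f g : Profile) → Ψ k (λ h → f h + g h) ≈ Ψ k f + Ψ k g
    Ψ-+ zero    f g = tailSum-+ f g 0
    Ψ-+ (suc k) f g = begin
      Ψ k (λ h → f h + g h) + s * Ψ k (above (λ h → f h + g h))
        ≈⟨ +-cong (Ψ-+ k f g) (*-congˡ (trans (Ψ-cong k (λ h → tailSum-+ f g (suc h))) (Ψ-+ k (above f) (above g)))) ⟩
      (Ψ k f + Ψ k g) + s * (Ψ k (above f) + Ψ k (above g))
        ≈⟨ solve 5 (λ a b c d x → (a :+ b) :+ x :* (c :+ d) := (a :+ x :* c) :+ (b :+ x :* d)) refl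
             (Ψ k f) (Ψ k g) (Ψ k (above f)) (Ψ k (above g)) s ⟩
      (Ψ k f + s * Ψ k (above f)) + (Ψ k g + s * Ψ k (above g)) ∎

    Ψ-* : ∀ k a (f : Profile) → Ψ k (λ h → a * f h) ≈ a * Ψ k f
    Ψ-* zero    a f = tailSum-* a f 0
    Ψ-* (suc k) a f = begin
      Ψ k (λ h → a * f h) + s * Ψ k (above (λ h → a * f h))
        ≈⟨ +-cong (Ψ-* k a f) (*-congˡ (trans (Ψ-cong k (λ h → tailSum-* a f (suc h))) (Ψ-* k a (above f)))) ⟩
      a * Ψ k f + s * (a * Ψ k (above f))
        ≈⟨ solve 4 (λ a b c x → a :* b :+ x :* (a :* c) := a :* (b :+ x :* c)) refl a (Ψ k f) (Ψ k (above f)) s ⟩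
      a * (Ψ k f + s * Ψ k (above f)) ∎

    Ψ-zero : ∀ k {f : Profile} → (∀ h → f h ≈ 0#) → Ψ k f ≈ 0#
    Ψ-zero k {f} eq = trans (Ψ-cong k (λ h → trans (eq h) (sym (zeroˡ (f h))))) (trans (Ψ-* k 0# f) (zeroˡ _))

    Ψ-δ : ∀ k → Ψ k δ ≈ 1#
    Ψ-δ zero    = trans (+-congˡ (∑-zero B (λ _ _ → refl))) (+-identityʳ 1#)
    Ψ-δ (suc k) = trans (+-cong (Ψ-δ k) (*-congˡ (Ψ-zero k (λ h → ∑-zero (suc B) (λ _ _ → refl)))))
                        (trans (+-congˡ (zeroʳ s)) (+-identityʳ 1#))

    Ψ-unfold : ∀ k (f : Profile) → Ψ k f ≈ total f + s * ∑[ i < k ] Ψ i (above f)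
    Ψ-unfold zero    f = sym (trans (+-congˡ (zeroʳ s)) (+-identityʳ _))
    Ψ-unfold (suc k) f = begin
      Ψ k f + s * Ψ k (above f) ≈⟨ +-congʳ (Ψ-unfold k f) ⟩
      (total f + s * ∑[ i < k ] Ψ i (above f)) + s * Ψ k (above f)
        ≈⟨ solve 4 (λ a b c x → (a :+ x :* b) :+ x :* c := a :+ x :* (b :+ c)) refl
             (total f) (∑[ i < k ] Ψ i (above f)) (Ψ k (above f)) s ⟩
      total f + s * (∑[ i < k ] Ψ i (above f) + Ψ k (above f))
        ≈⟨ +-congˡ (*-congˡ (sym (∑-last k (λ i → Ψ i (above f))))) ⟩
      total f + s * ∑[ i < suc k ] Ψ i (above f) ∎

    tailSum-shiftUp-above : ∀ (f : Profile) h → tailSum f h ≈ shiftUp (above f) h + total f * δ h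
    tailSum-shiftUp-above f zero    = sym (trans (+-identityˡ _) (*-identityʳ _))
    tailSum-shiftUp-above f (suc h) = sym (trans (+-congˡ (zeroʳ _)) (+-identityʳ _))

    above-step : ∀ (f : Profile) h → above (step f) h ≈ step (above f) h + total f * δ h
    above-step f h = begin
      tailSum (step f) (suc h)
        ≈⟨ Linear.φ-step (λ g → tailSum g (suc h)) (λ f g → tailSum-+ f g (suc h)) (λ a f → tailSum-* a f (suc h)) f ⟩
      tailSum f h + above f h + s * (above f h + above (above f) h) + s * above (above f) h
        ≈⟨ +-congʳ (+-congʳ (+-congʳ (tailSum-shiftUp-above f h))) ⟩
      (shiftUp (above f) h + total f * δ h) + above f h + s * (above f h + above (above f) h) + s * above (above f) h
        ≈⟨ solve 5 (λ a b c d x → (a :+ b) :+ c :+ x :* (c :+ d) :+ x :* d := (a :+ c :+ x :* (c :+ d) :+ x :* d) :+ b) refl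
             (shiftUp (above f) h) (total f * δ h) (above f h) (above (above f) h) s ⟩
      step (above f) h + total f * δ h ∎

    total-shiftUp : ∀ {f : Profile} → Bounded f → total (shiftUp f) ≈ total f
    total-shiftUp {f} bounded = trans (tailSum-∷ (shiftUp f) 0 (bounded B ℕ.≤-refl)) (+-identityˡ _)

    -- The transfer identity: one step of the height recursion acts on Ψ like one step of W⁺
    Ψ-step : ∀ k (f : Profile) → Bounded f → Ψ k (step f) ≈ (Ψ (suc k) f + Ψ (suc k) f) + s * ∑[ i < suc k ] Ψ i f
    Ψ-step zero f bounded = begin
      Ψ zero (step f)
        ≈⟨ Linear.φ-step total (λ f g → tailSum-+ f g 0) (λ a f → tailSum-* a f 0) f ⟩
      total (shiftUp f) + total f + s * (total f + total (above f)) + s * total (above f)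
        ≈⟨ +-congʳ (+-congʳ (+-congʳ (total-shiftUp bounded))) ⟩
      total f + total f + s * (total f + total (above f)) + s * total (above f)
        ≈⟨ solve 3 (λ a b x → a :+ a :+ x :* (a :+ b) :+ x :* b := (a :+ x :* b) :+ (a :+ x :* b) :+ x :* (a :+ con 0)) refl
             (total f) (total (above f)) s ⟩
      (total f + s * total (above f)) + (total f + s * total (above f)) + s * (total f + 0#) ∎
    Ψ-step (suc k) f bounded = begin
      Ψ k (step f) + s * Ψ k (above (step f))
        ≈⟨ +-cong (Ψ-step k f bounded) (*-congˡ (trans (Ψ-cong k (above-step f)) (trans (Ψ-+ k _ _)
             (+-cong (Ψ-step k (above f) (above-bounded bounded)) (trans (Ψ-* k (total f) δ) (*-congˡ (Ψ-δ k))))))) ⟩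
      (A + A + s * Σ) + s * ((A' + A' + s * Σ') + total f * 1#)
        ≈⟨ solve 6 (λ a b c d e x → (a :+ a :+ x :* b) :+ x :* ((c :+ c :+ x :* d) :+ e :* con 1)
                                   := (a :+ x :* c) :+ (a :+ x :* c) :+ x :* (b :+ (e :+ x :* d))) refl A Σ A' Σ' (total f) s ⟩
      (A + s * A') + (A + s * A') + s * (Σ + (total f + s * Σ'))
        ≈⟨ +-congˡ (*-congˡ (+-congˡ (sym (Ψ-unfold (suc k) f)))) ⟩
      (A + s * A') + (A + s * A') + s * (Σ + A)
        ≈⟨ +-congˡ (*-congˡ (sym (∑-last (suc k) (λ i → Ψ i f)))) ⟩
      (A + s * A') + (A + s * A') + s * ∑[ i < suc (suc k) ] Ψ i f ∎
      where
      A  = Ψ (suc k) f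
      Σ  = ∑[ i < suc k ] Ψ i f
      A' = Ψ (suc k) (above f)
      Σ' = ∑[ i < suc k ] Ψ i (above f)

    Ψ₀ : ℕ → Profile → Carrier
    Ψ₀ k f = f 0 + s * ∑[ i < k ] Ψ i (shiftDown f)

    Ψ₀-cong : ∀ k {f g : Profile} → (∀ h → f h ≈ g h) → Ψ₀ k f ≈ Ψ₀ k g
    Ψ₀-cong k eq = +-cong (eq 0) (*-congˡ (∑-cong k (λ i → Ψ-cong i (eq ∘ suc))))

    Ψ₀-suc : ∀ k (f : Profile) → Ψ₀ (suc k) f ≈ Ψ₀ k f + s * Ψ k (shiftDown f)
    Ψ₀-suc k f = begin
      f 0 + s * ∑[ i < suc k ] Ψ i (shiftDown f) ≈⟨ +-congˡ (*-congˡ (∑-last k (λ i → Ψ i (shiftDown f)))) ⟩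
      f 0 + s * (∑[ i < k ] Ψ i (shiftDown f) + Ψ k (shiftDown f))
        ≈⟨ solve 4 (λ a b c x → a :+ x :* (b :+ c) := (a :+ x :* b) :+ x :* c) refl
             (f 0) (∑[ i < k ] Ψ i (shiftDown f)) (Ψ k (shiftDown f)) s ⟩
      Ψ₀ k f + s * Ψ k (shiftDown f) ∎

    Ψ-shiftDown : ∀ k (f : Profile) → Bounded f → Ψ k f ≈ Ψ k (shiftDown f) + Ψ₀ k f
    Ψ-shiftDown zero    f bounded = trans (tailSum-∷-bounded bounded 0)
                                          (trans (+-comm _ _) (+-congˡ (sym (trans (+-congˡ (zeroʳ s)) (+-identityʳ _)))))
    Ψ-shiftDown (suc k) f bounded = begin
      Ψ k f + s * Ψ k (above f)
        ≈⟨ +-cong (Ψ-shiftDown k f bounded) (*-congˡ (Ψ-shiftDown k (above f) (above-bounded bounded))) ⟩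
      (a + (f 0 + s * Σ)) + s * (b + (above f 0 + s * Σ'))
        ≈⟨ solve 7 (λ a b c d Σ Σ' x → (a :+ (c :+ x :* Σ)) :+ x :* (b :+ (d :+ x :* Σ'))
                                     := (a :+ x :* b) :+ (c :+ x :* (Σ :+ (d :+ x :* Σ')))) refl
             a b (f 0) (above f 0) Σ Σ' s ⟩
      (a + s * b) + (f 0 + s * (Σ + (above f 0 + s * Σ')))
        ≈⟨ +-congˡ (+-congˡ (*-congˡ (+-congˡ (sym (Ψ-unfold k (shiftDown f)))))) ⟩
      (a + s * b) + (f 0 + s * (Σ + a))
        ≈⟨ +-congˡ (+-congˡ (*-congˡ (sym (∑-last k (λ i → Ψ i (shiftDown f)))))) ⟩
      Ψ (suc k) (shiftDown f) + Ψ₀ (suc k) f ∎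
      where
      a  = Ψ k (shiftDown f)
      b  = Ψ k (above (shiftDown f))
      Σ  = ∑[ i < k ] Ψ i (shiftDown f)
      Σ' = ∑[ i < k ] Ψ i (shiftDown (above f))

    shiftDown-step : ∀ (f : Profile) h → shiftDown (step f) h ≈ step (shiftDown f) h + f 0 * δ h
    shiftDown-step f zero =
      solve 4 (λ a b c x → a :+ b :+ x :* (b :+ c) :+ x :* c := (con 0 :+ b :+ x :* (b :+ c) :+ x :* c) :+ a :* con 1)
        refl (f 0) (f 1) (above f 1) s
    shiftDown-step f (suc h) =
      solve 5 (λ a b c x z → a :+ b :+ x :* (b :+ c) :+ x :* c := (a :+ b :+ x :* (b :+ c) :+ x :* c) :+ z :* con 0)
        refl (f (suc h)) (f (suc (suc h))) (above f (suc (suc h))) s (f 0)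

    Ψ₀-step : ∀ k (f : Profile) → Bounded f → Ψ₀ k (step f) ≈ Ψ₀ (suc k) f + s * ∑[ i < suc k ] Ψ i f
    Ψ₀-step zero f bounded = begin
      Ψ₀ 0 (step f) ≡⟨⟩
      0# + f 0 + s * (f 0 + a) + s * a + s * 0#
        ≈⟨ solve 3 (λ b a x → con 0 :+ b :+ x :* (b :+ a) :+ x :* a :+ x :* con 0
                           := (b :+ x :* (a :+ con 0)) :+ x :* ((b :+ a) :+ con 0)) refl (f 0) a s ⟩
      (f 0 + s * (a + 0#)) + s * ((f 0 + a) + 0#) ≈⟨ +-congˡ (*-congˡ (+-congʳ (sym (tailSum-∷-bounded bounded 0)))) ⟩
      (f 0 + s * (a + 0#)) + s * (total f + 0#) ∎
      where a = above f 0
    Ψ₀-step (suc k) f bounded = begin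
      Ψ₀ (suc k) (step f) ≈⟨ Ψ₀-suc k (step f) ⟩
      Ψ₀ k (step f) + s * Ψ k (shiftDown (step f))
        ≈⟨ +-cong (Ψ₀-step k f bounded) (*-congˡ (trans (Ψ-cong k (shiftDown-step f))
             (trans (Ψ-+ k (step (shiftDown f)) (λ h → f 0 * δ h))
             (+-cong (Ψ-step k (shiftDown f) (shiftDown-bounded bounded)) (trans (Ψ-* k (f 0) δ) (*-congˡ (Ψ-δ k))))))) ⟩
      (P + s * Σ) + s * ((Q + Q + s * Σ') + f 0 * 1#)
        ≈⟨ solve 6 (λ t a b c z x → (t :+ x :* a) :+ x :* ((b :+ b :+ x :* c) :+ z :* con 1)
                                  := (t :+ x :* b) :+ x :* (a :+ (b :+ (z :+ x :* c)))) refl P Σ Q Σ' (f 0) s ⟩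
      (P + s * Q) + s * (Σ + (Q + Ψ₀ (suc k) f))
        ≈⟨ +-cong (sym (Ψ₀-suc (suc k) f)) (*-congˡ (+-congˡ (sym (Ψ-shiftDown (suc k) f bounded)))) ⟩
      Ψ₀ (suc (suc k)) f + s * (Σ + Ψ (suc k) f)
        ≈⟨ +-congˡ (*-congˡ (sym (∑-last (suc k) (λ i → Ψ i f)))) ⟩
      Ψ₀ (suc (suc k)) f + s * ∑[ i < suc (suc k) ] Ψ i f ∎
      where
      P  = Ψ₀ (suc k) f
      Σ  = ∑[ i < suc k ] Ψ i f
      Q  = Ψ (suc k) (shiftDown f)
      Σ' = ∑[ i < suc k ] Ψ i (shiftDown f)

    module _ (V : ℕ → Profile)
             (V-zero : ∀ h → V 0 h ≈ δ h)
             (V-suc : ∀ j → j < B → ∀ h → V (suc j) h ≈ step (V j) h)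
             (V-bounded : ∀ j → j < B → Bounded (V j)) where
      open Recurrences R s

      W⁺≈Ψ : ∀ j → j < B → ∀ k → W⁺ k j ≈ Ψ k (V j)
      W⁺≈Ψ zero    _   k = sym (trans (Ψ-cong k V-zero) (Ψ-δ k))
      W⁺≈Ψ (suc j) j<B k = begin
        (W⁺ (suc k) j + W⁺ (suc k) j) + s * ∑[ i < suc k ] W⁺ i j
          ≈⟨ +-cong (+-cong (W⁺≈Ψ j j<B' (suc k)) (W⁺≈Ψ j j<B' (suc k))) (*-congˡ (∑-cong (suc k) (W⁺≈Ψ j j<B'))) ⟩
        (Ψ (suc k) (V j) + Ψ (suc k) (V j)) + s * ∑[ i < suc k ] Ψ i (V j) ≈⟨ Ψ-step k (V j) (V-bounded j j<B') ⟨
        Ψ k (step (V j))                                                  ≈⟨ Ψ-cong k (V-suc j j<B') ⟨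
        Ψ k (V (suc j))                                                   ∎
        where j<B' = ℕ.<⇒≤ j<B

      W⁰≈Ψ₀ : ∀ j → j < B → ∀ k → W⁰ k j ≈ Ψ₀ k (V j)
      W⁰≈Ψ₀ zero    _   k = sym (trans (+-cong (V-zero 0) (*-congˡ (∑-zero k (λ i _ → Ψ-zero i (V-zero ∘ suc)))))
                                       (trans (+-congˡ (zeroʳ s)) (+-identityʳ 1#)))
      W⁰≈Ψ₀ (suc j) j<B k = begin
        W⁰ (suc k) j + s * ∑[ i < suc k ] W⁺ i j
          ≈⟨ +-cong (W⁰≈Ψ₀ j j<B' (suc k)) (*-congˡ (∑-cong (suc k) (W⁺≈Ψ j j<B'))) ⟩
        Ψ₀ (suc k) (V j) + s * ∑[ i < suc k ] Ψ i (V j) ≈⟨ Ψ₀-step k (V j) (V-bounded j j<B') ⟨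
        Ψ₀ k (step (V j))                               ≈⟨ Ψ₀-cong k (V-suc j j<B') ⟨
        Ψ₀ k (V (suc j))                                ∎
        where j<B' = ℕ.<⇒≤ j<B

      W⁰-ground : ∀ n → n < B → W⁰ 0 n ≈ V n 0
      W⁰-ground n n<B = trans (W⁰≈Ψ₀ n n<B 0) (trans (+-congˡ (zeroʳ s)) (+-identityʳ _))

module SchroederPaths {c ℓ : Level} (R : CommutativeSemiring c ℓ) (s : CommutativeSemiring.Carrier R) where
  open CommutativeSemiring R hiding (zero)
  open FiniteSums R
  open import Relation.Binary.Reasoning.Setoid setoid
  open import Algebra.Solver.Ring.NaturalCoefficients.Default R

  suffixWeight : ℕ → Bool → List Step → Carrier
  suffixWeight h up q = if validFrom h q then pow R s (ascFrom up q) else 0#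

  suffixGF : Bool → ℕ → ℕ → Carrier
  suffixGF up h w = listSum (suffixWeight h up) (words w)

  ascentCost : Bool → Carrier
  ascentCost true  = 1#
  ascentCost false = s

  downGF : ℕ → ℕ → Carrier
  downGF zero    w = 0#
  downGF (suc h) w = suffixGF false h w

  flatGF : ℕ → ℕ → Carrier
  flatGF h zero    = 0#
  flatGF h (suc w) = suffixGF false h w

  validFrom-U : ∀ h q → validFrom h (U ∷ q) ≡ validFrom (suc h) q
  validFrom-U zero    q = ≡.refl
  validFrom-U (suc h) q = ≡.refl

  validFrom-F : ∀ h q → validFrom h (F ∷ q) ≡ validFrom h q
  validFrom-F zero    q = ≡.refl
  validFrom-F (suc h) q = ≡.refl

  suffixWeight-U : ∀ h up q → suffixWeight h up (U ∷ q) ≈ ascentCost up * suffixWeight (suc h) true q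
  suffixWeight-U h up q rewrite validFrom-U h q with validFrom (suc h) q | up
  ... | true  | true  = sym (*-identityˡ _)
  ... | true  | false = refl
  ... | false | true  = sym (*-identityˡ 0#)
  ... | false | false = sym (zeroʳ s)

  suffixWeight-F : ∀ h up q → suffixWeight h up (F ∷ q) ≡ suffixWeight h false q
  suffixWeight-F h up q rewrite validFrom-F h q = ≡.refl

  suffixGF-U : ∀ up h w → listSum (suffixWeight h up) (map (U ∷_) (words w)) ≈ ascentCost up * suffixGF true (suc h) w
  suffixGF-U up h w = trans (reflexive (listSum-map _ _ (words w)))
                     (trans (listSum-cong (suffixWeight-U h up) (words w)) (listSum-*ˡ (ascentCost up) _ (words w)))

  suffixGF-D : ∀ up h w → listSum (suffixWeight h up) (map (D ∷_) (words w)) ≈ downGF h w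
  suffixGF-D up zero    w = trans (reflexive (listSum-map _ _ (words w))) (listSum-zero (λ _ → refl) (words w))
  suffixGF-D up (suc h) w = reflexive (listSum-map _ _ (words w))

  suffixGF-F : ∀ up h w → listSum (suffixWeight h up) (map (F ∷_) (words w)) ≈ suffixGF false h w
  suffixGF-F up h w = trans (reflexive (listSum-map _ _ (words w))) (listSum-cong (reflexive ∘ suffixWeight-F h up) (words w))

  suffixGF-suc : ∀ up h w → suffixGF up h (suc w) ≈ ascentCost up * suffixGF true (suc h) w + downGF h w + flatGF h w
  suffixGF-suc up h zero = trans (listSum-++ (suffixWeight h up) (map (U ∷_) (words 0)) (map (D ∷_) (words 0)))
    (trans (+-cong (suffixGF-U up h 0) (suffixGF-D up h 0)) (sym (+-identityʳ _)))
  suffixGF-suc up h (suc w) = begin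
    listSum (suffixWeight h up) (map (U ∷_) (words (suc w)) ++ map (D ∷_) (words (suc w)) ++ map (F ∷_) (words w))
      ≈⟨ listSum-++ (suffixWeight h up) (map (U ∷_) (words (suc w))) _ ⟩
    _ + listSum (suffixWeight h up) (map (D ∷_) (words (suc w)) ++ map (F ∷_) (words w))
      ≈⟨ +-congˡ (listSum-++ (suffixWeight h up) (map (D ∷_) (words (suc w))) _) ⟩
    _ + (_ + _)
      ≈⟨ +-cong (suffixGF-U up h (suc w)) (+-cong (suffixGF-D up h (suc w)) (suffixGF-F up h w)) ⟩
    ascentCost up * suffixGF true (suc h) (suc w) + (downGF h (suc w) + flatGF h (suc w))
      ≈⟨ +-assoc _ _ _ ⟨
    ascentCost up * suffixGF true (suc h) (suc w) + downGF h (suc w) + flatGF h (suc w) ∎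

  open Profiles R s

  suffixGF-ground : ∀ up h → suffixGF up h 0 ≈ δ h
  suffixGF-ground up zero    = +-identityʳ _
  suffixGF-ground up (suc h) = +-identityʳ _

  suffixGF-vanishes : ∀ w up h → w < h → suffixGF up h w ≈ 0#
  suffixGF-vanishes zero    up (suc h) _   = +-identityʳ _
  suffixGF-vanishes (suc w) up h       w<h = begin
    suffixGF up h (suc w)                                                  ≈⟨ suffixGF-suc up h w ⟩
    ascentCost up * suffixGF true (suc h) w + downGF h w + flatGF h w
      ≈⟨ +-cong (+-cong ups≈0 (downs≈0 h w<h)) (flats≈0 w w<h) ⟩
    0# + 0# + 0#                                                           ≈⟨ trans (+-identityʳ _) (+-identityʳ _) ⟩
    0#                                                                     ∎
    where
    ups≈0 : ascentCost up * suffixGF true (suc h) w ≈ 0#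
    ups≈0 = trans (*-congˡ (suffixGF-vanishes w true (suc h) (ℕ.<-trans (ℕ.n<1+n w) (ℕ.m<n⇒m<1+n w<h)))) (zeroʳ _)
    downs≈0 : ∀ h → suc w < h → downGF h w ≈ 0#
    downs≈0 (suc h) (s≤s w<h) = suffixGF-vanishes w false h w<h
    flats≈0 : ∀ w → suc w < h → flatGF h w ≈ 0#
    flats≈0 zero    _   = refl
    flats≈0 (suc w) w<h = suffixGF-vanishes w false h (ℕ.<-trans (ℕ.n<1+n w) (ℕ.<-trans (ℕ.n<1+n (suc w)) w<h))

  -- suffixes from height h of width 2j − h, i.e. those completing a Schröder j-path
  heightProfile : ℕ → Profile
  heightProfile j h = suffixGF false h (j ℕ.+ j ℕ.∸ h)

  heightProfile-width : ∀ j h w → w ℕ.+ h ≡ j ℕ.+ j → heightProfile j h ≈ suffixGF false h w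
  heightProfile-width j h w w+h≡2j =
    reflexive (cong (suffixGF false h) (≡.trans (cong (ℕ._∸ h) (≡.sym w+h≡2j)) (ℕ.m+n∸n≡m w h)))

  heightProfile-vanishes : ∀ j h → j < h → heightProfile j h ≈ 0#
  heightProfile-vanishes j (suc h) j<h = suffixGF-vanishes _ false (suc h) (ℕ.m<n+o⇒m∸n<o (j ℕ.+ j) (suc h) (ℕ.+-mono-< j<h j<h))

  heightProfile-zero : ∀ h → heightProfile 0 h ≈ δ h
  heightProfile-zero zero    = suffixGF-ground false zero
  heightProfile-zero (suc h) = suffixGF-ground false (suc h)

  SP-GF : ∀ n → genSum R asc s (SP n) ≈ heightProfile n 0
  SP-GF n = listSum-filterᵇ _ (validFrom 0) (words (n ℕ.+ n))

  module _ (B : ℕ) where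
    open Truncated B

    heightProfile-bounded : ∀ j → j < B → Bounded (heightProfile j)
    heightProfile-bounded j j<B h B≤h = heightProfile-vanishes j h (ℕ.<-≤-trans j<B B≤h)

    landing : ℕ → Profile
    landing j h = shiftUp (heightProfile j) h + heightProfile j h

    downGF+flatGF : ∀ j h w → suc w ℕ.+ h ≡ suc j ℕ.+ suc j → downGF h w + flatGF h w ≈ landing j h
    downGF+flatGF j h w eq = +-cong (down h eq) (flat w eq)
      where
      twice-suc : suc j ℕ.+ suc j ≡ suc (suc (j ℕ.+ j))
      twice-suc = cong suc (ℕ.+-suc j j)
      suc-suc-injective : ∀ {n} → suc (suc n) ≡ suc j ℕ.+ suc j → n ≡ j ℕ.+ j
      suc-suc-injective eq = ℕ.suc-injective (ℕ.suc-injective (≡.trans eq twice-suc))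
      down : ∀ h → suc w ℕ.+ h ≡ suc j ℕ.+ suc j → downGF h w ≈ shiftUp (heightProfile j) h
      down zero    _  = refl
      down (suc h) eq = sym (heightProfile-width j h w (suc-suc-injective (≡.trans (cong suc (≡.sym (ℕ.+-suc w h))) eq)))
      flat : ∀ w → suc w ℕ.+ h ≡ suc j ℕ.+ suc j → flatGF h w ≈ heightProfile j h
      flat zero    eq = sym (heightProfile-vanishes j h
        (≡.subst (j <_) (≡.sym (ℕ.suc-injective (≡.trans eq twice-suc))) (s≤s (ℕ.m≤m+n j j))))
      flat (suc w) eq = sym (heightProfile-width j h w (suc-suc-injective eq))

    landing-vanishes : ∀ j h → suc j < h → landing j h ≈ 0#
    landing-vanishes j (suc h) (s≤s j<h) =
      trans (+-cong (heightProfile-vanishes j h j<h) (heightProfile-vanishes j (suc h) (ℕ.m<n⇒m<1+n j<h))) (+-identityʳ 0#)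

    ascentGF : ∀ j → j < B → ∀ w h → w ℕ.+ h ≡ suc j ℕ.+ suc j → suffixGF true h w ≈ tailSum (landing j) h
    ascentGF j j<B zero    .(suc j ℕ.+ suc j) ≡.refl = trans (suffixGF-ground true (suc j ℕ.+ suc j)) (sym
      (∑-zero (suc B) (λ i _ → landing-vanishes j _ (s≤s (ℕ.≤-trans (ℕ.m≤n+m (suc j) j) (ℕ.m≤m+n _ i))))))
    ascentGF j j<B (suc w) h eq = begin
      suffixGF true h (suc w)                                   ≈⟨ suffixGF-suc true h w ⟩
      1# * suffixGF true (suc h) w + downGF h w + flatGF h w    ≈⟨ +-assoc _ _ _ ⟩
      1# * suffixGF true (suc h) w + (downGF h w + flatGF h w)
        ≈⟨ +-cong (trans (*-identityˡ _) (ascentGF j j<B w (suc h) (≡.trans (ℕ.+-suc w h) eq))) (downGF+flatGF j h w eq) ⟩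
      tailSum (landing j) (suc h) + landing j h                 ≈⟨ +-comm _ _ ⟩
      landing j h + tailSum (landing j) (suc h)
        ≈⟨ tailSum-∷ (landing j) h (landing-vanishes j _ (s≤s (ℕ.≤-trans j<B (ℕ.m≤n+m B h)))) ⟨
      tailSum (landing j) h                                     ∎

    heightProfile-suc : ∀ j → j < B → ∀ h → heightProfile (suc j) h ≈ step (heightProfile j) h
    heightProfile-suc j j<B h with h ℕ.≤? suc j
    ... | yes h≤j+1 = begin
      heightProfile (suc j) h                                    ≈⟨ heightProfile-width (suc j) h (suc w) eq ⟩
      suffixGF false h (suc w)                                   ≈⟨ suffixGF-suc false h w ⟩
      s * suffixGF true (suc h) w + downGF h w + flatGF h w      ≈⟨ +-assoc _ _ _ ⟩
      s * suffixGF true (suc h) w + (downGF h w + flatGF h w)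
        ≈⟨ +-cong (*-congˡ (ascentGF j j<B w (suc h) (≡.trans (ℕ.+-suc w h) eq))) (downGF+flatGF j h w eq) ⟩
      s * tailSum (landing j) (suc h) + landing j h              ≈⟨ +-congʳ (*-congˡ (tailSum-+ (shiftUp V) V (suc h))) ⟩
      s * (tailSum V h + above V h) + (shiftUp V h + V h)
        ≈⟨ +-congʳ (*-congˡ (+-congʳ (tailSum-∷-bounded (heightProfile-bounded j j<B) h))) ⟩
      s * ((V h + above V h) + above V h) + (shiftUp V h + V h)
        ≈⟨ solve 5 (λ a b c d x → x :* ((b :+ c) :+ d) :+ (a :+ b) := a :+ b :+ x :* (b :+ c) :+ x :* d) refl
             (shiftUp V h) (V h) (above V h) (above V h) s ⟩
      step V h                                                   ∎
      where
      V = heightProfile j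
      w = (j ℕ.+ suc j) ℕ.∸ h
      eq : suc w ℕ.+ h ≡ suc j ℕ.+ suc j
      eq = cong suc (ℕ.m∸n+n≡m (ℕ.≤-trans h≤j+1 (ℕ.m≤n+m (suc j) j)))
    ... | no h≰j+1 = trans (heightProfile-vanishes (suc j) h j+1<h) (sym (begin
      shiftUp V h + V h + s * (V h + above V h) + s * above V h
        ≈⟨ +-cong (+-cong (+-cong (shiftUp-vanishes h j+1<h) V≈0) (*-congˡ (+-cong V≈0 above≈0))) (*-congˡ above≈0) ⟩
      0# + 0# + s * (0# + 0#) + s * 0#
        ≈⟨ solve 1 (λ x → con 0 :+ con 0 :+ x :* (con 0 :+ con 0) :+ x :* con 0 := con 0) refl s ⟩
      0# ∎))
      where
      V = heightProfile j
      j+1<h : suc j < h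
      j+1<h = ℕ.≰⇒> h≰j+1
      j<h : j < h
      j<h = ℕ.<-trans (ℕ.n<1+n j) j+1<h
      V≈0 : V h ≈ 0#
      V≈0 = heightProfile-vanishes j h j<h
      shiftUp-vanishes : ∀ h → suc j < h → shiftUp V h ≈ 0#
      shiftUp-vanishes (suc h) (s≤s j<h) = heightProfile-vanishes j h j<h
      above≈0 : above V h ≈ 0#
      above≈0 = ∑-zero (suc B) (λ i _ → heightProfile-vanishes j (suc h ℕ.+ i)
                  (ℕ.<-≤-trans j<h (ℕ.≤-trans (ℕ.n≤1+n h) (ℕ.m≤m+n (suc h) i))))

mainTheorem5 : {c ℓ : Level} (R : CommutativeSemiring c ℓ) (s : CommutativeSemiring.Carrier R)
    (n : ℕ) → CommutativeSemiring._≈_ R (genSum R dist s (I021 (suc n))) (genSum R asc s (SP n))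
mainTheorem5 R s n = begin
  genSum R dist s (I021 (suc n))   ≈⟨ I021-GF n ⟩
  W⁰ 0 n                           ≈⟨ W⁰-ground (suc n) heightProfile heightProfile-zero
                                        (heightProfile-suc (suc n)) (heightProfile-bounded (suc n)) n (ℕ.n<1+n n) ⟩
  heightProfile n 0                ≈⟨ SP-GF n ⟨
  genSum R asc s (SP n)            ∎
  where
  open CommutativeSemiring R using (setoid)
  open import Relation.Binary.Reasoning.Setoid setoid
  open Recurrences R s
  open InversionSequences R s
  open Profiles R s using (module Truncated)
  open Truncated using (W⁰-ground)
  open SchroederPaths R s
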